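{- Let $x_i$ and $x_j$ ($i\ne j$) be two occurrences of a repeat $x$ in $\pi$. In $ACG(\pi,\tau,f)$, if $l(x_i)$ and $l(x_j)$ (or $r(x_i)$ and $r(x_j)$) are joined by a blue edge, then $x_i$ and $x_j$ have different orientations; and if $l(x_i)$ and $r(x_j)$ (or $r(x_i)$ and $l(x_j)$) are joined by a blue edge, then $x_i$ and $x_j$ have the same orientation.
   Context: Fix genes $\Sigma_1$ and repeats $\Sigma_2\ni r_0$. A chromosome is a sequence $\pi=[x_0,\dots,x_{n+1}]$ of signed symbols ($x_i=\pm a$, $|x_i|=a$; the sign is the orientation) with $x_0=+r_0$, $x_{n+1}=-r_0$, every gene occurring exactly once. Nodes are labelled $(l(x_i),r(x_i))=(a^h,a^t)$ if $x_i=+a$, $(a^t,a^h)$ if $x_i=-a$. Adjacencies: unordered pairs $\langle r(x_i),l(x_{i+1})\rangle$ at the gaps $0\le i\le n$; $\mathcal{A}[\pi]$ is their multiset. Let $\pi,\tau$ be related chromosomes with $\mathcal{A}[\pi]=\mathcal{A}[\tau]$. $ACG(\pi,\tau,f)$: $f$ is a bijection between the gaps of $\pi$ and of $\tau$ sending each adjacency to an identical one (left end matched to left end, right end to right end). For each occurrence $x_i$ of $\pi$ create two distinct nodes $l(x_i),r(x_i)$ joined by a red edge. For each occurrence $y_k$ of $\tau$: among the nodes of $\pi$ bordering the gap matched to the left gap of $y_k$ take the one labelled $l(y_k)$, among those bordering the gap matched to the right gap of $y_k$ take the one labelled $r(y_k)$, and join them by a blue edge. -}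

module Defs where

open import Data.Bool using (Bool; true; false)
open import Data.Nat using (ℕ; suc)
open import Data.Fin using (Fin; zero; suc; inject₁; fromℕ)
open import Data.Product using (Σ; ∃; _×_; _,_)
open import Data.Sum using (_⊎_; inj₁; inj₂)
open import Function.Bundles using (_↔_; Inverse)
open import Relation.Binary.PropositionalEquality using (_≡_)

Symbol : Set → Set → Set
Symbol Gn Rp = Gn ⊎ Rp

data Sign : Set where
  plus minus : Sign

record Signed (Gn Rp : Set) : Set where
  constructor _·_
  field
    sign   : Sign
    symbol : Symbol Gn Rp
open Signed public

data End : Set where
  head tail : End

Label : Set → Set → Set
Label Gn Rp = Symbol Gn Rp × End

lab-l : {Gn Rp : Set} → Signed Gn Rp → Label Gn Rp
lab-l (plus · a)  = a , head
lab-l (minus · a) = a , tail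

lab-r : {Gn Rp : Set} → Signed Gn Rp → Label Gn Rp
lab-r (plus · a)  = a , tail
lab-r (minus · a) = a , head

-- A chromosome [x₀ , … , x_{n+1}] : occurrences indexed by Fin (2 + n),
-- gaps indexed by Fin (1 + n); gap i lies between occurrences
-- inject₁ i and suc i.
record Chromosome {Gn Rp : Set} (r₀ : Rp) (n : ℕ) : Set where
  field
    occ        : Fin (suc (suc n)) → Signed Gn Rp
    first      : occ zero ≡ (plus · inj₂ r₀)
    last       : occ (fromℕ (suc n)) ≡ (minus · inj₂ r₀)
    gene-exist : (g : Gn) → ∃ λ i → symbol (occ i) ≡ inj₁ g
    gene-once  : (g : Gn) (i j : Fin (suc (suc n))) →
                 symbol (occ i) ≡ inj₁ g → symbol (occ j) ≡ inj₁ g → i ≡ j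
open Chromosome public

adj : {Gn Rp : Set} {r₀ : Rp} {n : ℕ} → Chromosome {Gn} {Rp} r₀ n →
      Fin (suc n) → Label Gn Rp × Label Gn Rp
adj π i = lab-r (occ π (inject₁ i)) , lab-l (occ π (suc i))

SameAdj : {A : Set} → A × A → A × A → Set
SameAdj (a , b) (c , d) = (a ≡ c × b ≡ d) ⊎ (a ≡ d × b ≡ c)

-- 𝒜[π] = 𝒜[τ] as multisets: a bijection of gaps preserving adjacencies.
Related : {Gn Rp : Set} {r₀ : Rp} {n : ℕ} →
          Chromosome {Gn} {Rp} r₀ n → Chromosome {Gn} {Rp} r₀ n → Set
Related {n = n} π τ =
  Σ (Fin (suc n) ↔ Fin (suc n)) λ σ →
    (g : Fin (suc n)) → SameAdj (adj π (Inverse.to σ g)) (adj τ g)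

-- How the two ends of a τ-adjacency are matched to the ends of the
-- corresponding π-adjacency (with identical labels):
-- false = left↦left, right↦right ; true = left↦right, right↦left.
EndsMatch : {A : Set} → Bool → A × A → A × A → Set
EndsMatch false (a , b) (c , d) = a ≡ c × b ≡ d
EndsMatch true  (a , b) (c , d) = a ≡ d × b ≡ c

-- The data f of ACG(π,τ,f): a bijection from the gaps of τ to the gaps
-- of π, with for each gap the matching of its ends, labels preserved.
record GapMatching {Gn Rp : Set} {r₀ : Rp} {n : ℕ}
                   (π τ : Chromosome {Gn} {Rp} r₀ n) : Set where
  field
    gap     : Fin (suc n) ↔ Fin (suc n)
    flip    : Fin (suc n) → Bool
    matches : (g : Fin (suc n)) →
              EndsMatch (flip g) (adj τ g) (adj π (Inverse.to gap g))
open GapMatching public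

data Node (n : ℕ) : Set where
  L R : Fin (suc (suc n)) → Node n

-- Node of π matched to the right end of τ-gap g (the end labelled l(y_{g+1})).
rightEndNode : {Gn Rp : Set} {r₀ : Rp} {n : ℕ} {π τ : Chromosome {Gn} {Rp} r₀ n} →
               GapMatching π τ → Fin (suc n) → Node n
rightEndNode f g with flip f g
... | false = L (suc (Inverse.to (gap f) g))
... | true  = R (inject₁ (Inverse.to (gap f) g))

-- Node of π matched to the left end of τ-gap g (the end labelled r(y_g)).
leftEndNode : {Gn Rp : Set} {r₀ : Rp} {n : ℕ} {π τ : Chromosome {Gn} {Rp} r₀ n} →
              GapMatching π τ → Fin (suc n) → Node n
leftEndNode f g with flip f g
... | false = R (inject₁ (Inverse.to (gap f) g))
... | true  = L (suc (Inverse.to (gap f) g))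

-- Blue edge for the occurrence y_k, k = j+1 (1 ≤ k ≤ n), of τ: its left gap
-- is inject₁ j, its right gap is suc j.  It joins the node labelled l(y_k)
-- at the π-gap matched to the left gap with the node labelled r(y_k) at the
-- π-gap matched to the right gap.
blueL : {Gn Rp : Set} {r₀ : Rp} {n : ℕ} {π τ : Chromosome {Gn} {Rp} r₀ n} →
        GapMatching π τ → Fin n → Node n
blueL f j = rightEndNode f (inject₁ j)

blueR : {Gn Rp : Set} {r₀ : Rp} {n : ℕ} {π τ : Chromosome {Gn} {Rp} r₀ n} →
        GapMatching π τ → Fin n → Node n
blueR f j = leftEndNode f (suc j)

BlueEdge : {Gn Rp : Set} {r₀ : Rp} {n : ℕ} {π τ : Chromosome {Gn} {Rp} r₀ n} →
           GapMatching π τ → Node n → Node n → Set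
BlueEdge {n = n} f u v =
  ∃ λ (j : Fin n) → (blueL f j ≡ u × blueR f j ≡ v) ⊎ (blueL f j ≡ v × blueR f j ≡ u)

-- A blue edge is drawn for a single occurrence y of τ: f matches its ends to
-- a node labelled l(y) and a node labelled r(y), so the two endpoints carry
-- different extremities (one head, one tail).  The extremity of l(x) or r(x)
-- is determined by the orientation of x, which turns "different extremities"
-- into the stated sign relations.
module Submission where

open import Defs
open import Data.Nat using (ℕ; suc)
open import Data.Fin as Fin using (Fin; inject₁)
open import Data.Product using (_×_; _,_; proj₂)
open import Data.Sum using (_⊎_; inj₁; inj₂)
open import Data.Bool using (true; false)
open import Relation.Binary.PropositionalEquality
  using (_≡_; _≢_; refl; sym; ≢-sym)

nodeLabel : {Gn Rp : Set} {r₀ : Rp} {n : ℕ} →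
            Chromosome {Gn} {Rp} r₀ n → Node n → Label Gn Rp
nodeLabel π (L i) = lab-l (occ π i)
nodeLabel π (R i) = lab-r (occ π i)

extremity : {Gn Rp : Set} → Label Gn Rp → End
extremity = proj₂

lab-l-extremity≢lab-r-extremity : {Gn Rp : Set} (y : Signed Gn Rp) →
                                  extremity (lab-l y) ≢ extremity (lab-r y)
lab-l-extremity≢lab-r-extremity (plus · _)  ()
lab-l-extremity≢lab-r-extremity (minus · _) ()

module _ {Gn Rp : Set} {r₀ : Rp} {n : ℕ} {π τ : Chromosome {Gn} {Rp} r₀ n}
         (f : GapMatching π τ) where

  nodeLabel-rightEndNode : (g : Fin (suc n)) →
                           nodeLabel π (rightEndNode f g) ≡ lab-l (occ τ (Fin.suc g))
  nodeLabel-rightEndNode g with flip f g | matches f g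
  ... | false | (_ , e) = sym e
  ... | true  | (_ , e) = sym e

  nodeLabel-leftEndNode : (g : Fin (suc n)) →
                          nodeLabel π (leftEndNode f g) ≡ lab-r (occ τ (inject₁ g))
  nodeLabel-leftEndNode g with flip f g | matches f g
  ... | false | (e , _) = sym e
  ... | true  | (e , _) = sym e

  blueL-extremity≢blueR-extremity : (j : Fin n) →
    extremity (nodeLabel π (blueL f j)) ≢ extremity (nodeLabel π (blueR f j))
  blueL-extremity≢blueR-extremity j
    rewrite nodeLabel-rightEndNode (inject₁ j) | nodeLabel-leftEndNode (Fin.suc j) =
    lab-l-extremity≢lab-r-extremity (occ τ (Fin.suc (inject₁ j)))

  blueEdge⇒extremity≢ : (u v : Node n) → BlueEdge f u v →
                        extremity (nodeLabel π u) ≢ extremity (nodeLabel π v)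
  blueEdge⇒extremity≢ _ _ (j , inj₁ (refl , refl)) = blueL-extremity≢blueR-extremity j
  blueEdge⇒extremity≢ _ _ (j , inj₂ (refl , refl)) = ≢-sym (blueL-extremity≢blueR-extremity j)

module _ {Gn Rp : Set} where

  lab-l-extremity≢⇒sign≢ : (x y : Signed Gn Rp) →
                           extremity (lab-l x) ≢ extremity (lab-l y) → sign x ≢ sign y
  lab-l-extremity≢⇒sign≢ (plus · _)  (plus · _)  e≢ _ = e≢ refl
  lab-l-extremity≢⇒sign≢ (minus · _) (minus · _) e≢ _ = e≢ refl
  lab-l-extremity≢⇒sign≢ (plus · _)  (minus · _) _ ()
  lab-l-extremity≢⇒sign≢ (minus · _) (plus · _)  _ ()

  lab-r-extremity≢⇒sign≢ : (x y : Signed Gn Rp) →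
                           extremity (lab-r x) ≢ extremity (lab-r y) → sign x ≢ sign y
  lab-r-extremity≢⇒sign≢ (plus · _)  (plus · _)  e≢ _ = e≢ refl
  lab-r-extremity≢⇒sign≢ (minus · _) (minus · _) e≢ _ = e≢ refl
  lab-r-extremity≢⇒sign≢ (plus · _)  (minus · _) _ ()
  lab-r-extremity≢⇒sign≢ (minus · _) (plus · _)  _ ()

  lab-l-lab-r-extremity≢⇒sign≡ : (x y : Signed Gn Rp) →
                                 extremity (lab-l x) ≢ extremity (lab-r y) → sign x ≡ sign y
  lab-l-lab-r-extremity≢⇒sign≡ (plus · _)  (plus · _)  _   = refl
  lab-l-lab-r-extremity≢⇒sign≡ (minus · _) (minus · _) _   = refl
  lab-l-lab-r-extremity≢⇒sign≡ (plus · _)  (minus · _) e≢ with () ← e≢ refl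
  lab-l-lab-r-extremity≢⇒sign≡ (minus · _) (plus · _)  e≢ with () ← e≢ refl

lemma12 : {Gene Rep : Set} (r₀ : Rep) (n : ℕ) (π τ : Chromosome {Gene} {Rep} r₀ n) →
          Related π τ → (f : GapMatching π τ) →
          (x : Rep) (i j : Fin (suc (suc n))) → i ≢ j →
          symbol (occ π i) ≡ inj₂ x → symbol (occ π j) ≡ inj₂ x →
          ((BlueEdge f (L i) (L j) ⊎ BlueEdge f (R i) (R j)) → sign (occ π i) ≢ sign (occ π j))
          × ((BlueEdge f (L i) (R j) ⊎ BlueEdge f (R i) (L j)) → sign (occ π i) ≡ sign (occ π j))
lemma12 _ _ π _ _ f _ i j _ _ _ = different-ends , opposite-ends
  where
  xᵢ = occ π i
  xⱼ = occ π j

  different-ends : BlueEdge f (L i) (L j) ⊎ BlueEdge f (R i) (R j) → sign xᵢ ≢ sign xⱼ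
  different-ends (inj₁ e) = lab-l-extremity≢⇒sign≢ xᵢ xⱼ (blueEdge⇒extremity≢ f _ _ e)
  different-ends (inj₂ e) = lab-r-extremity≢⇒sign≢ xᵢ xⱼ (blueEdge⇒extremity≢ f _ _ e)

  opposite-ends : BlueEdge f (L i) (R j) ⊎ BlueEdge f (R i) (L j) → sign xᵢ ≡ sign xⱼ
  opposite-ends (inj₁ e) = lab-l-lab-r-extremity≢⇒sign≡ xᵢ xⱼ (blueEdge⇒extremity≢ f _ _ e)
  opposite-ends (inj₂ e) =
    sym (lab-l-lab-r-extremity≢⇒sign≡ xⱼ xᵢ (≢-sym (blueEdge⇒extremity≢ f _ _ e)))
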